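{- Let $S$ be a set-valued tableau having at least one multicell. Then the dilation $di(S)$ is a set-valued tableau.
   Context: Partitions are drawn as Ferrers diagrams in French convention (row 1 is the bottom row; rows are numbered upward). A set-valued tableau of shape $\lambda$ fills each cell with a nonempty finite set of positive integers such that the maximum of each cell is $\le$ the minimum of the cell to its right and $<$ the minimum of the cell above it. A multicell is a cell containing more than one element. For a set-valued tableau $S$ with a multicell, $row(S)$ is the highest row containing a multicell, and $S_{>i}$ is the subtableau consisting of the rows strictly above row $i$ (a semistandard tableau when $i=row(S)$, with row $i+1$ as its bottom row). The dilation $di(S)$: let $c$ be the rightmost multicell in row $row(S)$ and $x$ the largest entry of $c$; remove $x$ from $c$ and Schensted row-insert $x$ into $S_{>row(S)}$, starting at row $row(S)+1$ (inserting $y$ into a row: if no entry exceeds $y$, append $y$ at the end of the row; otherwise $y$ replaces the leftmost entry strictly greater than $y$, and the displaced entry is inserted into the next row up). -}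

module Defs where

open import Data.Nat using (ℕ; zero; suc; _≤_; _<_; _<ᵇ_)
open import Data.Bool using (Bool; true; false; if_then_else_)
open import Data.List using (List; []; _∷_; [_]; length)
open import Data.Bool.ListAction using (any)
open import Data.List.Relation.Unary.All using (All)
open import Data.List.Relation.Unary.Any using (Any)
open import Data.List.Relation.Unary.Linked using (Linked)
open import Data.Maybe using (Maybe; just; nothing)
open import Data.Product using (_×_; _,_)
open import Data.Unit using (⊤)
open import Data.Empty using (⊥)

-- Representation (French convention)
-- A cell is a finite set of positive integers, stored as a strictly
-- increasing list.  A row is the list of its cells, left to right.
-- A tableau is the list of its rows, row 1 (the bottom row) first.

Cell : Set
Cell = List ℕ

Row : Set
Row = List Cell

Tableau : Set
Tableau = List Row

cmin : Cell → ℕ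
cmin []      = 0
cmin (a ∷ _) = a

cmax : Cell → ℕ
cmax []          = 0
cmax (a ∷ [])    = a
cmax (_ ∷ b ∷ r) = cmax (b ∷ r)

data NonEmpty {A : Set} : List A → Set where
  nonEmpty : ∀ {x xs} → NonEmpty (x ∷ xs)

IsCell : Cell → Set
IsCell c = NonEmpty c × All (λ a → 1 ≤ a) c × Linked _<_ c

RowOK : Row → Set
RowOK r = Linked (λ c d → cmax c ≤ cmin d) r

ColOK : Row → Row → Set
ColOK _       []      = ⊤
ColOK []      (_ ∷ _) = ⊥
ColOK (c ∷ r) (d ∷ s) = (cmax c < cmin d) × ColOK r s

-- rows are nonempty; row lengths weakly decrease upward (the shape is a
-- partition); all cells valid; row and column conditions hold
IsSVT : Tableau → Set
IsSVT T = All NonEmpty T × All (All IsCell) T × All RowOK T × Linked ColOK T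

Multicell : Cell → Set
Multicell c = 2 ≤ length c

HasMulticell : Tableau → Set
HasMulticell T = Any (Any Multicell) T

isMulti : Cell → Bool
isMulti (_ ∷ _ ∷ _) = true
isMulti _           = false

anyMulti : Tableau → Bool
anyMulti T = any (any isMulti) T

lastSplit : ℕ → List ℕ → List ℕ × ℕ
lastSplit a []       = [] , a
lastSplit a (b ∷ bs) with lastSplit b bs
... | i , l = a ∷ i , l

splitMax : Cell → Maybe (Cell × ℕ)
splitMax (a ∷ b ∷ r) = just (lastSplit a (b ∷ r))
splitMax _           = nothing

removeMaxRow : Row → Maybe (Row × ℕ)
removeMaxRow []       = nothing
removeMaxRow (c ∷ cs) with removeMaxRow cs
... | just (cs' , x) = just (c ∷ cs' , x)
... | nothing with splitMax c
...   | just (c' , x) = just (c' ∷ cs , x)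
...   | nothing       = nothing

-- Schensted insertion of y into a row (of singleton cells): y replaces the
-- leftmost entry strictly greater than y (which is bumped), or is appended
insRow : ℕ → Row → Row × Maybe ℕ
insRow y []       = [ [ y ] ] , nothing
insRow y (c ∷ cs) with y <ᵇ cmin c
... | true  = [ y ] ∷ cs , just (cmax c)
... | false with insRow y cs
...   | cs' , m = c ∷ cs' , m

insRows : ℕ → Tableau → Tableau
insRows y []       = [ [ [ y ] ] ]
insRows y (r ∷ rs) with insRow y r
... | r' , nothing = r' ∷ rs
... | r' , just z  = r' ∷ insRows z rs

-- dilation: find the highest row containing a multicell, remove the largest
-- entry x of its rightmost multicell, and row-insert x into the rows above.
-- (If there is no multicell, di is the identity; this case is excluded by
-- the hypothesis of the theorem.)
di : Tableau → Tableau
di []       = []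
di (r ∷ rs) with anyMulti rs
... | true  = r ∷ di rs
... | false with removeMaxRow r
...   | just (r' , x) = r' ∷ insRows x rs
...   | nothing       = r ∷ rs

-- Removing the largest entry x of a multicell keeps the minimum of that cell and lowers its
-- maximum, so the modified row stays valid and still sits correctly on the rows below it.
-- The rows above contain no multicell, so they form a semistandard tableau and Schensted
-- insertion keeps their row and column conditions.  The one new column condition is where x
-- lands in the row above: at the first cell whose minimum exceeds x, which (by the column
-- condition) lies no further right than the cell x came from; the cell below it is either
-- that cell, whose maximum is now below x, or a cell to its left, whose maximum is at most
-- the minimum of x's cell.  Each bumped entry is larger than the one that bumped it, and the
-- same argument carries the column condition up through every row the insertion visits.
module Submission where

open import Defs
open import Data.Nat using (ℕ; _≤_; _<_; _<ᵇ_; z≤n; s≤s)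
open import Data.Nat.Properties
  using (≤-refl; ≤-trans; <⇒≤; <⇒≱; <-trans; ≤-<-trans; ≮⇒≥; <ᵇ-reflects-<)
open import Data.Bool using (Bool; true; false)
open import Data.Bool.Properties using (∨-conicalˡ; ∨-conicalʳ)
open import Data.Bool.ListAction using (any)
open import Data.List using ([]; _∷_; [_])
open import Data.List.Relation.Unary.All as All using (All; []; _∷_)
open import Data.List.Relation.Unary.Linked as Linked using (Linked; []; [-]; _∷_)
open import Data.List.Relation.Binary.Pointwise as Pointwise using (Pointwise; []; _∷_)
open import Data.Maybe using (Maybe; just; nothing)
open import Data.Product using (_×_; _,_; proj₁; proj₂)
open import Data.Unit using (tt)
open import Data.Empty using (⊥-elim)
open import Relation.Binary.PropositionalEquality using (_≡_; refl; subst; sym)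
open import Relation.Nullary.Reflects using (ofʸ; ofⁿ)

cmin≤cmax : ∀ {c} → Linked _<_ c → cmin c ≤ cmax c
cmin≤cmax []      = ≤-refl
cmin≤cmax [-]     = ≤-refl
cmin≤cmax (p ∷ l) = ≤-trans (<⇒≤ p) (cmin≤cmax l)

singleton-isCell : ∀ {y} → 1 ≤ y → IsCell [ y ]
singleton-isCell 1≤y = nonEmpty , 1≤y ∷ [] , [-]

RowOK-lowerHead : ∀ {c c′ cs} → cmax c′ ≤ cmax c → RowOK (c ∷ cs) → RowOK (c′ ∷ cs)
RowOK-lowerHead c′≤c [-]       = [-]
RowOK-lowerHead c′≤c (c≤d ∷ l) = ≤-trans c′≤c c≤d ∷ l

record RemovesMax (c c′ : Cell) (x : ℕ) : Set where
  constructor removesMax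
  field
    isCell : IsCell c′
    cmin-≡ : cmin c′ ≡ cmin c
    cmax-< : cmax c′ < x
    cmax-≡ : cmax c ≡ x

lastSplit-removesMax : ∀ a b l → IsCell (a ∷ b ∷ l) →
  RemovesMax (a ∷ b ∷ l) (proj₁ (lastSplit a (b ∷ l))) (proj₂ (lastSplit a (b ∷ l)))
lastSplit-removesMax a b [] (_ , 1≤a ∷ _ , a<b ∷ _) = removesMax (singleton-isCell 1≤a) refl a<b refl
lastSplit-removesMax a b (b′ ∷ l) (_ , 1≤a ∷ pos , a<b ∷ inc)
  with lastSplit-removesMax b b′ l (nonEmpty , pos , inc)
... | removesMax (_ , pos′ , inc′) _ max< max≡ =
  removesMax (nonEmpty , 1≤a ∷ pos′ , a<b ∷ inc′) refl max< max≡

splitMax-removesMax : ∀ {c c′ x} → IsCell c → splitMax c ≡ just (c′ , x) → RemovesMax c c′ x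
splitMax-removesMax {a ∷ b ∷ l} cell refl = lastSplit-removesMax a b l cell

-- Nothing below uses that the multicell emptied of x is the rightmost one in its row.
data MaxRemoved : Row → Row → ℕ → Set where
  here  : ∀ {c c′ cs x} → RemovesMax c c′ x → MaxRemoved (c ∷ cs) (c′ ∷ cs) x
  there : ∀ {c cs cs′ x} → MaxRemoved cs cs′ x → MaxRemoved (c ∷ cs) (c ∷ cs′) x

removeMaxRow-maxRemoved : ∀ {r r′ x} → All IsCell r → removeMaxRow r ≡ just (r′ , x) →
  MaxRemoved r r′ x
removeMaxRow-maxRemoved {c ∷ cs} (cell ∷ cells) eq with removeMaxRow cs in removedAbove
... | just _ with refl ← eq = there (removeMaxRow-maxRemoved cells removedAbove)
... | nothing with splitMax c in split
...   | just _ with refl ← eq = here (splitMax-removesMax cell split)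

Shrunk : Cell → Cell → Set
Shrunk c c′ = cmin c′ ≡ cmin c × cmax c′ ≤ cmax c

maxRemoved-shrunk : ∀ {r r′ x} → MaxRemoved r r′ x → Pointwise Shrunk r r′
maxRemoved-shrunk (here (removesMax _ min≡ max< refl)) =
  (min≡ , <⇒≤ max<) ∷ Pointwise.refl (refl , ≤-refl)
maxRemoved-shrunk (there removed) = (refl , ≤-refl) ∷ maxRemoved-shrunk removed

maxRemoved-nonEmpty : ∀ {r r′ x} → MaxRemoved r r′ x → NonEmpty r′
maxRemoved-nonEmpty (here _)  = nonEmpty
maxRemoved-nonEmpty (there _) = nonEmpty

maxRemoved-cells : ∀ {r r′ x} → MaxRemoved r r′ x → All IsCell r → All IsCell r′
maxRemoved-cells (here (removesMax cell′ _ _ _)) (_ ∷ cells) = cell′ ∷ cells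
maxRemoved-cells (there removed) (cell ∷ cells)              = cell ∷ maxRemoved-cells removed cells

maxRemoved-positive : ∀ {r r′ x} → MaxRemoved r r′ x → 1 ≤ x
maxRemoved-positive (here (removesMax _ _ max< _)) = ≤-trans (s≤s z≤n) max<
maxRemoved-positive (there removed)                = maxRemoved-positive removed

maxRemoved-exceeds : ∀ {c r r′ x} → MaxRemoved r r′ x → All IsCell r → RowOK (c ∷ r) →
  cmax c < x
maxRemoved-exceeds (here (removesMax (_ , _ , inc′) min≡ max< _)) _ (c≤d ∷ _) =
  ≤-<-trans c≤d (subst (_< _) min≡ (≤-<-trans (cmin≤cmax inc′) max<))
maxRemoved-exceeds (there removed) ((_ , _ , inc) ∷ cells) (c≤d ∷ ro) =
  ≤-<-trans (≤-trans c≤d (cmin≤cmax inc)) (maxRemoved-exceeds removed cells ro)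

shrunk-rowOK : ∀ {r r′} → Pointwise Shrunk r r′ → RowOK r → RowOK r′
shrunk-rowOK []       []  = []
shrunk-rowOK (_ ∷ []) [-] = [-]
shrunk-rowOK ((_ , c′≤c) ∷ shrunk@((d′≡d , _) ∷ _)) (c≤d ∷ ro) =
  ≤-trans c′≤c (subst (_ ≤_) (sym d′≡d) c≤d) ∷ shrunk-rowOK shrunk ro

shrunk-colOK-below : ∀ {B r r′} → Pointwise Shrunk r r′ → ColOK B r → ColOK B r′
shrunk-colOK-below []                     tt          = tt
shrunk-colOK-below {_ ∷ _} ((min≡ , _) ∷ shrunk) (b<c , col) =
  subst (_ <_) (sym min≡) b<c , shrunk-colOK-below shrunk col

shrunk-colOK-above : ∀ {r r′ U} → Pointwise Shrunk r r′ → ColOK r U → ColOK r′ U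
shrunk-colOK-above {U = []}    _                    _           = tt
shrunk-colOK-above {U = _ ∷ _} ((_ , c′≤c) ∷ shrunk) (c<e , col) =
  ≤-<-trans c′≤c c<e , shrunk-colOK-above shrunk col

data Singleton : Cell → Set where
  singleton : ∀ a → Singleton [ a ]

Singletons : Row → Set
Singletons = All Singleton

data Inserts (y : ℕ) : Row → Row → Maybe ℕ → Set where
  append : Inserts y [] [ [ y ] ] nothing
  bump   : ∀ {a Q} → y < a → Inserts y ([ a ] ∷ Q) ([ y ] ∷ Q) (just a)
  pass   : ∀ {a Q Q′ m} → a ≤ y → Inserts y Q Q′ m → Inserts y ([ a ] ∷ Q) ([ a ] ∷ Q′) m

insRow-inserts : ∀ {y Q} → Singletons Q → Inserts y Q (proj₁ (insRow y Q)) (proj₂ (insRow y Q))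
insRow-inserts [] = append
insRow-inserts {y} (singleton a ∷ singletons) with y <ᵇ a | <ᵇ-reflects-< y a
... | true  | ofʸ y<a = bump y<a
... | false | ofⁿ y≮a = pass (≮⇒≥ y≮a) (insRow-inserts singletons)

inserts-nonEmpty : ∀ {y Q Q′ m} → Inserts y Q Q′ m → NonEmpty Q′
inserts-nonEmpty append     = nonEmpty
inserts-nonEmpty (bump _)   = nonEmpty
inserts-nonEmpty (pass _ _) = nonEmpty

inserts-cells : ∀ {y Q Q′ m} → 1 ≤ y → Inserts y Q Q′ m → All IsCell Q → All IsCell Q′
inserts-cells 1≤y append       []             = singleton-isCell 1≤y ∷ []
inserts-cells 1≤y (bump _)     (_ ∷ cells)    = singleton-isCell 1≤y ∷ cells
inserts-cells 1≤y (pass _ ins) (cell ∷ cells) = cell ∷ inserts-cells 1≤y ins cells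

inserts-rowOK-∷ : ∀ {y d Q Q′ m} → cmax d ≤ y → Inserts y Q Q′ m →
  RowOK (d ∷ Q) → RowOK (d ∷ Q′)
inserts-rowOK-∷ d≤y append         [-]        = d≤y ∷ [-]
inserts-rowOK-∷ d≤y (bump y<a)     (_ ∷ ro)   = d≤y ∷ RowOK-lowerHead (<⇒≤ y<a) ro
inserts-rowOK-∷ d≤y (pass a≤y ins) (d≤a ∷ ro) = d≤a ∷ inserts-rowOK-∷ a≤y ins ro

inserts-rowOK : ∀ {y Q Q′ m} → Inserts y Q Q′ m → RowOK Q → RowOK Q′
inserts-rowOK append         _  = [-]
inserts-rowOK (bump y<a)     ro = RowOK-lowerHead (<⇒≤ y<a) ro
inserts-rowOK (pass a≤y ins) ro = inserts-rowOK-∷ a≤y ins ro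

inserts-colOK-above : ∀ {y Q Q′ m U} → Inserts y Q Q′ m → ColOK Q U → ColOK Q′ U
inserts-colOK-above {U = []}    _              _           = tt
inserts-colOK-above {U = _ ∷ _} (bump y<a)     (a<e , col) = <-trans y<a a<e , col
inserts-colOK-above {U = _ ∷ _} (pass _ ins)   (a<e , col) = a<e , inserts-colOK-above ins col

inserts-bumped-> : ∀ {y Q Q′ z} → Inserts y Q Q′ (just z) → y < z
inserts-bumped-> (bump y<a)   = y<a
inserts-bumped-> (pass _ ins) = inserts-bumped-> ins

inserts-bumped-colOK : ∀ {y z Q Q′ U U′ m} → Inserts y Q Q′ (just z) → Inserts z U U′ m →
  ColOK Q U → ColOK Q′ U′
inserts-bumped-colOK (bump y<a)      append         _           = y<a , tt
inserts-bumped-colOK (bump y<a)      (bump _)       (_ , col)   = y<a , col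
inserts-bumped-colOK (bump _)        (pass e≤a _)   (a<e , _)   = ⊥-elim (<⇒≱ a<e e≤a)
inserts-bumped-colOK (pass a≤y insQ) append         _           =
  ≤-<-trans a≤y (inserts-bumped-> insQ) , tt
inserts-bumped-colOK (pass a≤y insQ) (bump _)       (_ , col)   =
  ≤-<-trans a≤y (inserts-bumped-> insQ) , inserts-colOK-above insQ col
inserts-bumped-colOK (pass _ insQ)   (pass _ insU)  (a<e , col) = a<e , inserts-bumped-colOK insQ insU col

maxRemoved-colOK : ∀ {r r′ x U U′ m} → MaxRemoved r r′ x → All IsCell r → RowOK r →
  Inserts x U U′ m → ColOK r U → ColOK r′ U′
maxRemoved-colOK (here (removesMax _ _ max< refl)) _ _ append         _           = max< , tt
maxRemoved-colOK (here (removesMax _ _ max< refl)) _ _ (bump _)       (_ , col)   = max< , col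
maxRemoved-colOK (here (removesMax _ _ _ refl))    _ _ (pass e≤x _)   (x<e , _)   =
  ⊥-elim (<⇒≱ x<e e≤x)
maxRemoved-colOK (there removed) (_ ∷ cells) ro append _ =
  maxRemoved-exceeds removed cells ro , tt
maxRemoved-colOK (there removed) (_ ∷ cells) ro (bump _) (_ , col) =
  maxRemoved-exceeds removed cells ro , shrunk-colOK-above (maxRemoved-shrunk removed) col
maxRemoved-colOK (there removed) (_ ∷ cells) ro (pass _ insU) (c<e , col) =
  c<e , maxRemoved-colOK removed cells (Linked.tail ro) insU col

-- The empty row stands for the missing row above the top of a tableau: ColOK r [] holds.
bottomRow : Tableau → Row
bottomRow []      = []
bottomRow (r ∷ _) = r

IsSVT-∷ : ∀ {r T} → NonEmpty r → All IsCell r → RowOK r → ColOK r (bottomRow T) → IsSVT T →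
  IsSVT (r ∷ T)
IsSVT-∷ {T = []}    ne cells ro _   _                          = ne ∷ [] , cells ∷ [] , ro ∷ [] , [-]
IsSVT-∷ {T = _ ∷ _} ne cells ro col (nes , cellss , ros , cols) =
  ne ∷ nes , cells ∷ cellss , ro ∷ ros , col ∷ cols

IsSVT-uncons : ∀ {r T} → IsSVT (r ∷ T) →
  NonEmpty r × All IsCell r × RowOK r × ColOK r (bottomRow T) × IsSVT T
IsSVT-uncons {T = []}    (ne ∷ [] , cells ∷ [] , ro ∷ [] , [-]) =
  ne , cells , ro , tt , [] , [] , [] , []
IsSVT-uncons {T = _ ∷ _} (ne ∷ nes , cells ∷ cellss , ro ∷ ros , col ∷ cols) =
  ne , cells , ro , col , nes , cellss , ros , cols

bottomRow-singletons : ∀ {T} → All Singletons T → Singletons (bottomRow T)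
bottomRow-singletons []      = []
bottomRow-singletons (s ∷ _) = s

any≡false : ∀ {A : Set} (p : A → Bool) xs → any p xs ≡ false → All (λ x → p x ≡ false) xs
any≡false p []       _  = []
any≡false p (x ∷ xs) eq =
  ∨-conicalˡ (p x) (any p xs) eq ∷ any≡false p xs (∨-conicalʳ (p x) (any p xs) eq)

nonMulti-singleton : ∀ {c} → IsCell c → isMulti c ≡ false → Singleton c
nonMulti-singleton {a ∷ []} _ _ = singleton a

noMulticell-singletons : ∀ T → All (All IsCell) T → anyMulti T ≡ false → All Singletons T
noMulticell-singletons T cellss noMulti = All.zipWith row (cellss , any≡false (any isMulti) T noMulti)
  where
  row : ∀ {r} → All IsCell r × any isMulti r ≡ false → Singletons r
  row {r} (cells , eq) =
    All.zipWith (λ (cell , e) → nonMulti-singleton cell e) (cells , any≡false isMulti r eq)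

insRows-valid : ∀ {y L T} → 1 ≤ y → All Singletons T → IsSVT T →
  ColOK L (proj₁ (insRow y (bottomRow T))) →
  ColOK L (bottomRow (insRows y T)) × IsSVT (insRows y T)
insRows-valid {T = []} 1≤y _ _ col =
  col , nonEmpty ∷ [] , (singleton-isCell 1≤y ∷ []) ∷ [] , [-] ∷ [] , [-]
insRows-valid {y} {T = Q ∷ T} 1≤y (singletons ∷ singletonss) svt col
  with IsSVT-uncons svt | insRow y Q | insRow-inserts {y} singletons
... | _ , cells , ro , colQ , svtAbove | _ , nothing | ins =
  col , IsSVT-∷ (inserts-nonEmpty ins) (inserts-cells 1≤y ins cells) (inserts-rowOK ins ro)
                (inserts-colOK-above ins colQ) svtAbove
... | _ , cells , ro , colQ , svtAbove | _ , just _ | ins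
  with insRows-valid (≤-trans 1≤y (<⇒≤ (inserts-bumped-> ins))) singletonss svtAbove
         (inserts-bumped-colOK ins (insRow-inserts (bottomRow-singletons singletonss)) colQ)
...   | colAbove , svtAbove′ =
  col , IsSVT-∷ (inserts-nonEmpty ins) (inserts-cells 1≤y ins cells) (inserts-rowOK ins ro)
                colAbove svtAbove′

maxRemoved-insRows-valid : ∀ {r r′ x T} → MaxRemoved r r′ x → All Singletons T → IsSVT (r ∷ T) →
  IsSVT (r′ ∷ insRows x T)
maxRemoved-insRows-valid removed singletonss svt with IsSVT-uncons svt
... | _ , cells , ro , col , svtAbove
  with insRows-valid (maxRemoved-positive removed) singletonss svtAbove
         (maxRemoved-colOK removed cells ro (insRow-inserts (bottomRow-singletons singletonss)) col)
...   | colAbove , svtAbove′ =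
  IsSVT-∷ (maxRemoved-nonEmpty removed) (maxRemoved-cells removed cells)
          (shrunk-rowOK (maxRemoved-shrunk removed) ro) colAbove svtAbove′

di-bottomRow-colOK : ∀ {B T} → IsSVT T → ColOK B (bottomRow T) → ColOK B (bottomRow (di T))
di-bottomRow-colOK {T = []} _ col = col
di-bottomRow-colOK {T = r ∷ T} svt col with IsSVT-uncons svt | anyMulti T
... | _ | true = col
... | _ , cells , _ | false with removeMaxRow r in removed
...   | nothing = col
...   | just _  = shrunk-colOK-below (maxRemoved-shrunk (removeMaxRow-maxRemoved cells removed)) col

di-valid : ∀ S → IsSVT S → IsSVT (di S)
di-valid []       svt = svt
di-valid (r ∷ rs) svt with IsSVT-uncons svt | anyMulti rs in anyMultiAbove
... | ne , cells , ro , col , svtAbove | true =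
  IsSVT-∷ ne cells ro (di-bottomRow-colOK svtAbove col) (di-valid rs svtAbove)
... | _ , cells , _ , _ , (_ , cellss , _) | false with removeMaxRow r in removed
...   | nothing = svt
...   | just _  = maxRemoved-insRows-valid (removeMaxRow-maxRemoved cells removed)
                    (noMulticell-singletons rs cellss anyMultiAbove) svt

mainTheorem2 : (S : Tableau) → IsSVT S → HasMulticell S → IsSVT (di S)
mainTheorem2 S svt _ = di-valid S svt
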